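{- Every block graph is a Helly-$B_1$-EPG graph.
   Context: All graphs are finite and simple. A block graph is a graph in which every biconnected component (block) is a clique. An EPG representation of a graph $G$ assigns to each vertex $v$ a path $P_v$ in the (rectangular) grid such that two distinct vertices are adjacent in $G$ if and only if their paths share at least one grid edge. A $B_1$-EPG representation is an EPG representation in which every path has at most one bend. It is Helly if every subfamily of its paths that pairwise share a grid edge has a grid edge common to all paths of the subfamily. A graph is Helly-$B_1$-EPG if it admits a Helly $B_1$-EPG representation. -}

module Defs where

open import Data.Bool using (Bool; true; false; T)
open import Data.Nat using (ℕ)
open import Data.Fin using (Fin)
open import Data.Fin.Subset using (Subset; _∈_; _⊆_)
open import Data.Integer using (ℤ; _≤_; _<_; _⊓_; _⊔_)
open import Data.Product using (Σ; ∃; _×_)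
open import Relation.Nullary using (¬_)
open import Relation.Binary.PropositionalEquality using (_≡_; _≢_)
open import Function.Bundles using (_⇔_)

record Graph (n : ℕ) : Set where
  field
    adj     : Fin n → Fin n → Bool
    sym     : ∀ u v → adj u v ≡ adj v u
    irrefl  : ∀ u → adj u u ≡ false

module _ {n : ℕ} (G : Graph n) where
  open Graph G

  Adj : Fin n → Fin n → Set
  Adj u v = T (adj u v)

  data Reach (P : Fin n → Set) : Fin n → Fin n → Set where
    here : ∀ {u} → P u → Reach P u u
    step : ∀ {u w v} → P u → Adj u w → Reach P w v → Reach P u v

  -- the subgraph induced by P is connected
  -- (the empty graph counts as connected)
  ConnectedOn : (Fin n → Set) → Set
  ConnectedOn P = ∀ u v → P u → P v → Reach P u v

  ConnNoCut : Subset n → Set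
  ConnNoCut S =
    ConnectedOn (λ x → x ∈ S) ×
    (∀ w → w ∈ S → ConnectedOn (λ x → x ∈ S × x ≢ w))

  IsBlock : Subset n → Set
  IsBlock S = ConnNoCut S × (∀ T → S ⊆ T → ConnNoCut T → T ⊆ S)

  IsClique : Subset n → Set
  IsClique S = ∀ u v → u ∈ S → v ∈ S → u ≢ v → Adj u v

  IsBlockGraph : Set
  IsBlockGraph = ∀ S → IsBlock S → IsClique S

data GridEdge : Set where
  -- hor x y : the edge between (x , y) and (x + 1 , y)
  hor : ℤ → ℤ → GridEdge
  -- ver x y : the edge between (x , y) and (x , y + 1)
  ver : ℤ → ℤ → GridEdge

-- A path with at most one bend: a horizontal segment from (hx , cy) to
-- the bend point (cx , cy), followed by a vertical segment from
-- (cx , cy) to (cx , vy).  At least one of the segments is non-trivial,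
-- so the path has at least one grid edge.  (If one segment is trivial
-- the path has no bend.)
record B1Path : Set where
  field
    cx cy hx vy : ℤ
    nontrivial  : ¬ (hx ≡ cx × vy ≡ cy)

_∈ₚ_ : GridEdge → B1Path → Set
hor x y ∈ₚ P = y ≡ B1Path.cy P × (B1Path.hx P ⊓ B1Path.cx P ≤ x) × (x < B1Path.hx P ⊔ B1Path.cx P)
ver x y ∈ₚ P = x ≡ B1Path.cx P × (B1Path.vy P ⊓ B1Path.cy P ≤ y) × (y < B1Path.vy P ⊔ B1Path.cy P)

ShareEdge : B1Path → B1Path → Set
ShareEdge P Q = ∃ λ e → e ∈ₚ P × e ∈ₚ Q

module _ {n : ℕ} (G : Graph n) where

  IsB1EPGRep : (Fin n → B1Path) → Set
  IsB1EPGRep P = ∀ u v → u ≢ v → (Adj G u v ⇔ ShareEdge (P u) (P v))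

  IsHelly : (Fin n → B1Path) → Set
  IsHelly P = ∀ (S : Subset n) →
    (∀ u v → u ∈ S → v ∈ S → ShareEdge (P u) (P v)) →
    ∃ λ e → ∀ u → u ∈ S → e ∈ₚ P u

  IsHellyB1EPG : Set
  IsHellyB1EPG = Σ (Fin n → B1Path) λ P → IsB1EPGRep P × IsHelly P

{-# OPTIONS --safe #-}
-- Root every component of the block graph and group the children of each vertex by the block
-- they share with it: then two distinct vertices are adjacent exactly when one is the parent of
-- the other or both lie in the same block below a common parent. The forest is built vertex by
-- vertex, a new vertex being attached below its highest neighbour; its remaining neighbours
-- form one block of children there because every cycle of a block graph spans a clique.
-- Each vertex gets an L-shaped path: an arm on the grid line of its parent, inside a window
-- reserved for its block, and a stem on a grid line of its own, the orientation alternating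
-- with the depth. Two paths share an edge exactly when their vertices are linked, and a
-- pairwise intersecting family is one block with possibly its parent, all of whose paths
-- contain the first edge of the block's window.
module Submission where

open import Defs
open import Data.Bool using (T)
open import Data.Empty using (⊥-elim)
open import Data.Fin using (Fin; _≟_; toℕ)
open import Data.Fin.Subset using (Subset; _∈_; _∉_; _⊆_; ∣_∣; _∪_; ⁅_⁆) renaming (⊥ to ∅)
open import Data.Fin.Subset.Properties
  using (_∈?_; p⊂q⇒∣p∣<∣q∣; ∣p∣≤n; ∉⊥; p⊆p∪q; x∈p∪q⁺; x∈p∪q⁻; x∈⁅x⁆; x∈⁅y⁆⇒x≡y)
open import Data.Fin.Properties using (any?; toℕ<n; toℕ-injective)
open import Data.List using (List; []; _∷_)
open import Data.List.Membership.Propositional using () renaming (_∈_ to _∈ₗ_; _∉_ to _∉ₗ_)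
open import Data.List.Relation.Unary.All using (All; []; _∷_)
import Data.List.Relation.Unary.All as All
open import Data.List.Relation.Unary.All.Properties using (¬Any⇒All¬; All¬⇒¬Any)
open import Data.List.Relation.Unary.Any using (here; there)
import Data.List.Relation.Unary.Any as Any
open import Data.List.Relation.Unary.Unique.Propositional using (Unique; []; _∷_)
open import Data.Nat using (ℕ; zero; suc; _+_; _*_; _⊓_; _⊔_; _≤_; _<_; z≤n; s≤s; NonZero)
open import Data.Nat.DivMod using (_/_; m<n*o⇒m/o<n; m*n/n≡m; /-monoˡ-≤)
open import Data.Nat.Properties
  using ( ≤-refl; ≤-reflexive; ≤-trans; ≤-antisym; ≤-pred; <-irrefl; <-asym; <-trans; <-≤-trans; ≤-<-trans
        ; <⇒≢; <⇒≤; n≤1+n; m<n⇒m<1+n; suc-injective; m≤m+n; m≤n+m; m<m+n; +-comm; +-suc; +-identityʳ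
        ; +-monoˡ-≤; +-monoʳ-<; +-cancelˡ-≡; *-monoˡ-≤; m≤n⇒m⊓n≡m; m≤n⇒m⊔n≡n; m≥n⇒m⊓n≡n; m≥n⇒m⊔n≡m )
open import Data.Integer using (+_; +≤+; +<+)
import Data.Integer as ℤ
open import Data.Integer.Properties using (+-injective)
open import Data.Product using (Σ; ∃; _×_; _,_; proj₁; proj₂)
open import Data.Sum using (_⊎_; inj₁; inj₂)
open import Data.Vec using (tabulate)
open import Data.Vec.Properties using ([]=⇒lookup; lookup⇒[]=; lookup∘tabulate)
open import Data.Vec.Functional using (updateAt)
open import Data.Vec.Functional.Properties using (updateAt-updates; updateAt-minimal)
open import Relation.Nullary using (¬_; yes; no; does; contradiction)
open import Relation.Nullary.Decidable using (Dec; _×-dec_; ¬?; T?; decidable-stable)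
open import Relation.Binary.PropositionalEquality using (_≡_; _≢_; refl; sym; trans; subst; subst₂; cong)
open import Function using (_∘_; _$_; const)
open import Function.Bundles using (_⇔_; mk⇔; Equivalence)

private
  variable
    n : ℕ
    a b c u v w x y z : Fin n
    l : List (Fin n)
    P Q : Fin n → Set
    U : Subset n

m≤a+[1+k]∧a<b⇒m≤b+k : ∀ {m a b k} → m ≤ a + suc k → a < b → m ≤ b + k
m≤a+[1+k]∧a<b⇒m≤b+k {a = a} {b} {k} m≤a+1+k a<b =
  ≤-trans m≤a+1+k (subst (_≤ b + k) (sym (+-suc a k)) (+-monoˡ-≤ k a<b))

m≤a+0∧a<b⇒b≰m : ∀ {m a b} → m ≤ a + 0 → a < b → ¬ b ≤ m
m≤a+0∧a<b⇒b≰m {a = a} m≤a+0 a<b b≤m =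
  <-irrefl refl (<-≤-trans a<b (≤-trans b≤m (subst (_ ≤_) (+-identityʳ a) m≤a+0)))

module _ {N : ℕ} .{{_ : NonZero N}} where

  /-block : ∀ a {x} → a * N ≤ x → x < suc a * N → x / N ≡ a
  /-block a {x} lo hi = ≤-antisym (≤-pred (m<n*o⇒m/o<n hi)) (subst (_≤ x / N) (m*n/n≡m a N) (/-monoˡ-≤ N lo))

  digit< : ∀ a {r} → r < N → a * N + r < suc a * N
  digit< a {r} r<N = subst (a * N + r <_) (+-comm (a * N) N) (+-monoʳ-< (a * N) r<N)

  digits-injective : ∀ {a b r s} → a * N + r ≡ b * N + s → r < N → s < N → a ≡ b × r ≡ s
  digits-injective {a} {b} {r} {s} eq r<N s<N =
    a≡b , +-cancelˡ-≡ (a * N) r s (trans eq (cong (λ c → c * N + s) (sym a≡b)))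
    where
    a≡b : a ≡ b
    a≡b = trans (sym (/-block a (m≤m+n (a * N) r) (digit< a r<N))) (trans (cong (_/ N) eq) (/-block b (m≤m+n (b * N) s) (digit< b s<N)))

⊆⇒⊇⊎∣<∣ : {S S′ : Subset n} → S ⊆ S′ → S′ ⊆ S ⊎ ∣ S ∣ < ∣ S′ ∣
⊆⇒⊇⊎∣<∣ {S = S} {S′} S⊆S′ with any? (λ x → (x ∈? S′) ×-dec ¬? (x ∈? S))
... | yes (x , x∈S′ , x∉S) = inj₂ (p⊂q⇒∣p∣<∣q∣ (S⊆S′ , x , x∈S′ , x∉S))
... | no noNew = inj₁ λ {x} x∈S′ → decidable-stable (x ∈? S) λ x∉S → noNew (x , x∈S′ , x∉S)

fromList : List (Fin n) → Subset n
fromList l = tabulate (λ i → does (Any.any? (i ≟_) l))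

∈fromList⁺ : x ∈ₗ l → x ∈ fromList l
∈fromList⁺ {x = x} {l = l} x∈l with Any.any? (x ≟_) l in eq
... | yes _   = lookup⇒[]= x (fromList l) (trans (lookup∘tabulate _ x) (cong does eq))
... | no x∉l = contradiction x∈l x∉l

∈fromList⁻ : x ∈ fromList l → x ∈ₗ l
∈fromList⁻ {x = x} {l = l} x∈fromList with Any.any? (x ≟_) l in eq
... | yes x∈l = x∈l
... | no _ = contradiction (trans (sym ([]=⇒lookup x∈fromList)) (trans (lookup∘tabulate _ x) (cong does eq))) λ ()

-- Walks, simple paths and cycles in block graphs

module _ (G : Graph n) where
  open Graph G using (adj; irrefl) renaming (sym to adj-comm)

  adj-sym : Adj G u v → Adj G v u
  adj-sym {u = u} {v = v} = subst T (adj-comm u v)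

  adj⇒≢ : Adj G u v → u ≢ v
  adj⇒≢ {u = u} uv refl = subst T (irrefl u) uv

  reach-map : (∀ {x} → P x → Q x) → Reach G P u v → Reach G Q u v
  reach-map f (here p)     = here (f p)
  reach-map f (step p a r) = step (f p) a (reach-map f r)

  reach-source : Reach G P u v → P u
  reach-source (here p)     = p
  reach-source (step p _ _) = p

  reach-target : Reach G P u v → P v
  reach-target (here p)     = p
  reach-target (step _ _ r) = reach-target r

  infixr 5 _◅◅_
  _◅◅_ : Reach G P u v → Reach G P v w → Reach G P u w
  here _     ◅◅ r′ = r′
  step p a r ◅◅ r′ = step p a (r ◅◅ r′)

  reach-reverse : Reach G P u v → Reach G P v u
  reach-reverse (here p)     = here p
  reach-reverse (step p a r) = reach-reverse r ◅◅ step (reach-source r) (adj-sym a) (here p)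

  reach-via : (∀ {y} → Q y → Reach G P y c) → Q u → Q v → Reach G P u v
  reach-via toHub qu qv = toHub qu ◅◅ reach-reverse (toHub qv)

  data Path : Fin n → Fin n → List (Fin n) → Set where
    [_] : ∀ a → Path a a (a ∷ [])
    _◅_ : Adj G a c → Path c b l → Path a b (a ∷ l)

  path-source∈ : Path a b l → a ∈ₗ l
  path-source∈ [ _ ]   = here refl
  path-source∈ (_ ◅ _) = here refl

  path-target∈ : Path a b l → b ∈ₗ l
  path-target∈ [ _ ]   = here refl
  path-target∈ (_ ◅ π) = there (path-target∈ π)

  reach-path-source : Path a b l → y ∈ₗ l → Reach G (_∈ₗ l) y a
  reach-path-source [ _ ]   (here refl) = here (here refl)
  reach-path-source (_ ◅ _) (here refl) = here (here refl)
  reach-path-source (ac ◅ π) (there y∈l) =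
    reach-map there (reach-path-source π y∈l) ◅◅ step (there (path-source∈ π)) (adj-sym ac) (here (here refl))

  reach-path-target : Path a b l → y ∈ₗ l → Reach G (_∈ₗ l) y b
  reach-path-target [ _ ]    (here refl) = here (here refl)
  reach-path-target (ac ◅ π) (here refl) = step (here refl) ac (reach-map there (reach-path-target π (path-source∈ π)))
  reach-path-target (_ ◅ π)  (there y∈l) = reach-map there (reach-path-target π y∈l)

  there× : z ∈ₗ l × z ≢ w → z ∈ₗ a ∷ l × z ≢ w
  there× (z∈l , z≢w) = there z∈l , z≢w

  reach-path-avoiding : Path a b l → Unique l → y ∈ₗ l → y ≢ w →
    Reach G (λ z → z ∈ₗ l × z ≢ w) y a ⊎ Reach G (λ z → z ∈ₗ l × z ≢ w) y b
  reach-path-avoiding [ _ ] _ (here refl) y≢w = inj₁ (here (here refl , y≢w))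
  reach-path-avoiding (_ ◅ _) _ (here refl) y≢w = inj₁ (here (here refl , y≢w))
  reach-path-avoiding {a = a} {w = w} (ac ◅ π) (a∉ ∷ unique) (there y∈l) y≢w
    with reach-path-avoiding π unique y∈l y≢w | a ≟ w
  ... | inj₂ r | _ = inj₂ (reach-map there× r)
  ... | inj₁ r | no a≢w =
    inj₁ (reach-map there× r ◅◅ step (there× (reach-target r)) (adj-sym ac) (here (here refl , a≢w)))
  ... | inj₁ _ | yes refl =
    inj₂ (reach-map (λ z∈l → there z∈l , λ { refl → All¬⇒¬Any a∉ z∈l }) (reach-path-target π y∈l))

  record SimplePath (P : Fin n → Set) (a b : Fin n) : Set where
    field
      {vertices} : List (Fin n)
      path       : Path a b vertices
      unique     : Unique vertices
      inside     : All P vertices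

  suffixFrom : x ∈ₗ l → Path a b l → Unique l → All P l → SimplePath P x b
  suffixFrom (here refl) π@([ _ ]) unique inside = record { path = π ; unique = unique ; inside = inside }
  suffixFrom (here refl) π@(_ ◅ _) unique inside = record { path = π ; unique = unique ; inside = inside }
  suffixFrom (there x∈l) (_ ◅ π) (_ ∷ unique) (_ ∷ inside) = suffixFrom x∈l π unique inside

  simplify : Reach G P a b → SimplePath P a b
  simplify (here p) = record { path = [ _ ] ; unique = [] ∷ [] ; inside = p ∷ [] }
  simplify {a = a} (step p ac r) with simplify r
  ... | record { vertices = l ; path = π ; unique = unique ; inside = inside } with Any.any? (a ≟_) l
  ...   | yes a∈l = suffixFrom a∈l π unique inside
  ...   | no a∉l  = record { path = ac ◅ π ; unique = ¬Any⇒All¬ l a∉l ∷ unique ; inside = p ∷ inside }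

  cycle-connNoCut : Path a b l → Unique l → x ∉ₗ l → Adj G x a → Adj G x b → ConnNoCut G (fromList (x ∷ l))
  cycle-connNoCut {a = a} {b = b} {l = l} {x = x} π unique x∉l xa xb = connected , noCut
    where
    C = fromList (x ∷ l)

    x∈C : x ∈ C
    x∈C = ∈fromList⁺ {l = x ∷ l} (here refl)

    path⊆C : y ∈ₗ l → y ∈ C
    path⊆C y∈l = ∈fromList⁺ {l = x ∷ l} (there y∈l)

    connected : ConnectedOn G (_∈ C)
    connected _ _ = reach-via toX
      where
      toX : y ∈ C → Reach G (_∈ C) y x
      toX y∈C with ∈fromList⁻ {l = x ∷ l} y∈C
      ... | here refl = here y∈C
      ... | there y∈l = reach-map path⊆C (reach-path-source π y∈l) ◅◅ step (path⊆C (path-source∈ π)) (adj-sym xa) (here x∈C)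

    noCut : ∀ w → w ∈ C → ConnectedOn G (λ z → z ∈ C × z ≢ w)
    noCut w _ _ _ with x ≟ w
    ... | yes refl = reach-via toA
      where
      toA : y ∈ C × y ≢ x → Reach G (λ z → z ∈ C × z ≢ x) y a
      toA (y∈C , y≢x) with ∈fromList⁻ {l = x ∷ l} y∈C
      ... | here y≡x  = contradiction y≡x y≢x
      ... | there y∈l = reach-map (λ z∈l → path⊆C z∈l , λ { refl → x∉l z∈l }) (reach-path-source π y∈l)
    ... | no x≢w = reach-via toX
      where
      lift : z ∈ₗ l × z ≢ w → z ∈ C × z ≢ w
      lift (z∈l , z≢w) = path⊆C z∈l , z≢w

      toX : y ∈ C × y ≢ w → Reach G (λ z → z ∈ C × z ≢ w) y x
      toX (y∈C , y≢w) with ∈fromList⁻ {l = x ∷ l} y∈C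
      ... | here refl = here (y∈C , y≢w)
      ... | there y∈l with reach-path-avoiding π unique y∈l y≢w
      ...   | inj₁ r = reach-map lift r ◅◅ step (lift (reach-target r)) (adj-sym xa) (here (x∈C , x≢w))
      ...   | inj₂ r = reach-map lift r ◅◅ step (lift (reach-target r)) (adj-sym xb) (here (x∈C , x≢w))

  module _ (blockGraph : IsBlockGraph G) where

    -- Either S is maximal, or a proper superset is connected without cut vertex and hence, by
    -- induction on the room k ≥ n ∸ ∣ S ∣ above S, a clique.
    connNoCut⇒clique : ∀ S → ConnNoCut G S → IsClique G S
    connNoCut⇒clique S = go n S (m≤n+m n ∣ S ∣)
      where
      go : ∀ k S → n ≤ ∣ S ∣ + k → ConnNoCut G S → IsClique G S
      go zero S bound cnc = blockGraph S (cnc , maximal)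
        where
        maximal : ∀ S′ → S ⊆ S′ → ConnNoCut G S′ → S′ ⊆ S
        maximal S′ S⊆S′ _ with ⊆⇒⊇⊎∣<∣ S⊆S′
        ... | inj₁ S′⊆S = S′⊆S
        ... | inj₂ ∣S∣<∣S′∣ = ⊥-elim (m≤a+0∧a<b⇒b≰m bound ∣S∣<∣S′∣ (∣p∣≤n S′))
      go (suc k) S bound cnc u v u∈S v∈S u≢v =
        decidable-stable (T? (adj u v)) λ u≁v → u≁v (blockGraph S (cnc , maximal u≁v) u v u∈S v∈S u≢v)
        where
        maximal : ¬ Adj G u v → ∀ S′ → S ⊆ S′ → ConnNoCut G S′ → S′ ⊆ S
        maximal u≁v S′ S⊆S′ cnc′ with ⊆⇒⊇⊎∣<∣ S⊆S′
        ... | inj₁ S′⊆S = S′⊆S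
        ... | inj₂ ∣S∣<∣S′∣ =
          ⊥-elim (u≁v (go k S′ (m≤a+[1+k]∧a<b⇒m≤b+k bound ∣S∣<∣S′∣) cnc′ u v (S⊆S′ u∈S) (S⊆S′ v∈S) u≢v))

    commonNeighbour⇒adj : Reach G P a b → ¬ P x → Adj G x a → Adj G x b → a ≢ b → Adj G a b
    commonNeighbour⇒adj {x = x} r ¬Px xa xb a≢b with simplify r
    ... | record { vertices = l ; path = π ; unique = unique ; inside = inside } =
      connNoCut⇒clique (fromList (x ∷ l)) (cycle-connNoCut π unique x∉l xa xb) _ _
        (∈fromList⁺ {l = x ∷ l} (there (path-source∈ π))) (∈fromList⁺ {l = x ∷ l} (there (path-target∈ π))) a≢b
      where
      x∉l : x ∉ₗ l
      x∉l x∈l = ¬Px (All.lookup inside x∈l)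

    square⇒chord : Adj G x y → Adj G y z → Adj G z w → Adj G w x → x ≢ z → y ≢ w → Adj G x z
    square⇒chord {y = y} xy yz zw wx x≢z y≢w =
      commonNeighbour⇒adj {P = _≢ y} x⇝z (λ y≢y → y≢y refl) (adj-sym xy) yz x≢z
      where
      x⇝z = step (adj⇒≢ xy) (adj-sym wx) (step (λ w≡y → y≢w (sym w≡y)) (adj-sym zw) (here (adj⇒≢ (adj-sym yz))))

-- Block forests

record Node (n : ℕ) : Set where
  constructor node
  field
    depth  : ℕ
    parent : Fin n
    block  : Fin n

open Node

-- Roots are their own parents; u lies in the block labelled block (F u) among the children
-- of parent (F u), and only non-roots are subject to the DepthLaw below.
Forest : ℕ → Set
Forest n = Fin n → Node n

private
  variable
    μ ν μ′ ν′ : Node n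
    F : Forest n

data Linked (μ ν : Node n) (u w : Fin n) : Set where
  childOf   : parent μ ≡ w → Linked μ ν u w
  parentOf  : parent ν ≡ u → Linked μ ν u w
  sameBlock : μ ≡ ν → Linked μ ν u w

_∼⟨_⟩_ : Fin n → Forest n → Fin n → Set
u ∼⟨ F ⟩ w = Linked (F u) (F w) u w

linked-sym : Linked μ ν u w → Linked ν μ w u
linked-sym (childOf p)   = parentOf p
linked-sym (parentOf p)  = childOf p
linked-sym (sameBlock e) = sameBlock (sym e)

DepthLaw : Forest n → Fin n → Set
DepthLaw F u = parent (F u) ≢ u → suc (depth (F (parent (F u)))) ≡ depth (F u)

record IsBlockForest (G : Graph n) (F : Forest n) : Set where
  field
    depth-parent : ∀ u → DepthLaw F u
    adj⇒linked   : ∀ {u w} → u ≢ w → Adj G u w → u ∼⟨ F ⟩ w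
    linked⇒adj   : ∀ {u w} → u ≢ w → u ∼⟨ F ⟩ w → Adj G u w

node-≡ : depth μ ≡ depth ν → parent μ ≡ parent ν → block μ ≡ block ν → μ ≡ ν
node-≡ {μ = node _ _ _} {ν = node _ _ _} refl refl refl = refl

module _ {F : Forest n} (depth-parent : ∀ u → DepthLaw F u) where

  parent-depth< : parent (F u) ≡ w → u ≢ w → depth (F w) < depth (F u)
  parent-depth< {u = u} refl u≢p = ≤-reflexive (depth-parent u (u≢p ∘ sym))

  -- The centre is u or a child of u in S; a child of that child could not be linked with u.
  linkedFamily-centre : ∀ {S : Subset n} → (∀ {x y} → x ∈ S → y ∈ S → x ≢ y → x ∼⟨ F ⟩ y) → u ∈ S →
                        ∃ λ c → ∀ {x} → x ∈ S → x ≡ parent (F c) ⊎ F x ≡ F c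
  linkedFamily-centre {u = u} {S = S} linked u∈S with any? (λ w → (w ∈? S) ×-dec ((parent (F w) ≟ u) ×-dec ¬? (w ≟ u)))
  ... | no noChild = u , centre
    where
    centre : x ∈ S → x ≡ parent (F u) ⊎ F x ≡ F u
    centre {x = x} x∈S with x ≟ u
    ... | yes refl = inj₂ refl
    ... | no x≢u with linked x∈S u∈S x≢u
    ...   | childOf px≡u    = contradiction (x , x∈S , px≡u , x≢u) noChild
    ...   | parentOf pu≡x   = inj₁ (sym pu≡x)
    ...   | sameBlock Fx≡Fu = inj₂ Fx≡Fu
  ... | yes (w , w∈S , pw≡u , w≢u) = w , centre
    where
    centre : x ∈ S → x ≡ parent (F w) ⊎ F x ≡ F w
    centre {x = x} x∈S with x ≟ u | x ≟ w
    ... | yes refl | _        = inj₁ (sym pw≡u)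
    ... | no _     | yes refl = inj₂ refl
    ... | no x≢u   | no x≢w with linked x∈S w∈S x≢w
    ...   | parentOf pw≡x   = contradiction (trans (sym pw≡x) pw≡u) x≢u
    ...   | sameBlock Fx≡Fw = inj₂ Fx≡Fw
    ...   | childOf px≡w with linked x∈S u∈S x≢u
    ...     | childOf px≡u    = contradiction (trans (sym px≡w) px≡u) w≢u
    ...     | parentOf pu≡x   = ⊥-elim $
      <-irrefl refl (<-trans (parent-depth< px≡w x≢w) (<-trans (parent-depth< pu≡x (x≢u ∘ sym)) (parent-depth< pw≡u w≢u)))
    ...     | sameBlock Fx≡Fu = ⊥-elim $
      <-asym (parent-depth< pw≡u w≢u) (parent-depth< (trans (cong parent (sym Fx≡Fu)) px≡w) (w≢u ∘ sym))

-- Building a block forest one vertex at a time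

module _ (G : Graph n) where
  open Graph G using (adj)

  Boundary : Subset n → Fin n → Set
  Boundary U y = y ∈ U × ∃ λ z → z ∉ U × Adj G z y

  boundary? : ∀ U y → Dec (Boundary U y)
  boundary? U y = (y ∈? U) ×-dec any? (λ z → ¬? (z ∈? U) ×-dec T? (adj z y))

  record IsPartialBlockForest (U : Subset n) (F : Forest n) : Set where
    field
      parent∈            : u ∈ U → parent (F u) ∈ U
      block∈             : u ∈ U → block (F u) ∈ U
      depth-parent       : u ∈ U → DepthLaw F u
      adj⇒linked         : u ∈ U → w ∈ U → u ≢ w → Adj G u w → u ∼⟨ F ⟩ w
      linked⇒adj         : u ∈ U → w ∈ U → u ≢ w → u ∼⟨ F ⟩ w → Adj G u w
      boundary-connected : Boundary U y → Boundary U z → Reach G (_∈ U) y z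

  module Extension {U F} (forest : IsPartialBlockForest U F) {x} (x∉U : x ∉ U) where
    open IsPartialBlockForest forest

    U′ : Subset n
    U′ = U ∪ ⁅ x ⁆

    U⊆U′ : U ⊆ U′
    U⊆U′ = p⊆p∪q ⁅ x ⁆

    x∈U′ : x ∈ U′
    x∈U′ = x∈p∪q⁺ (inj₂ (x∈⁅x⁆ x))

    ∈U′⁻ : u ∈ U′ → u ∈ U ⊎ u ≡ x
    ∈U′⁻ u∈U′ with x∈p∪q⁻ U ⁅ x ⁆ u∈U′
    ... | inj₁ u∈U = inj₁ u∈U
    ... | inj₂ u∈⁅x⁆ = inj₂ (x∈⁅y⁆⇒x≡y x u∈⁅x⁆)

    ∣U∣<∣U′∣ : ∣ U ∣ < ∣ U′ ∣
    ∣U∣<∣U′∣ = p⊂q⇒∣p∣<∣q∣ (U⊆U′ , x , x∈U′ , x∉U)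

    F′ : Node n → Forest n
    F′ ν = updateAt F x (const ν)

    F′x≡ν : ∀ ν → F′ ν x ≡ ν
    F′x≡ν _ = updateAt-updates x F

    F′≡F : ∀ ν → u ∈ U → F′ ν u ≡ F u
    F′≡F _ u∈U = updateAt-minimal _ x F λ { refl → x∉U u∈U }

    relink : μ ≡ μ′ → ν ≡ ν′ → Linked μ ν u w → Linked μ′ ν′ u w
    relink = subst₂ (λ α β → Linked α β _ _)

    module _ (ν : Node n) where

      F′-closed : (f : Node n → Fin n) → (∀ {u} → u ∈ U → f (F u) ∈ U) → f ν ∈ U′ → u ∈ U′ → f (F′ ν u) ∈ U′
      F′-closed f closed fν∈U′ u∈U′ with ∈U′⁻ u∈U′
      ... | inj₁ u∈U  = subst (λ μ → f μ ∈ U′) (sym (F′≡F ν u∈U)) (U⊆U′ (closed u∈U))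
      ... | inj₂ refl = subst (λ μ → f μ ∈ U′) (sym (F′x≡ν ν)) fν∈U′

      F′-depth-parent : parent ν ∈ U′ → (parent ν ≢ x → suc (depth (F (parent ν))) ≡ depth ν) →
                        u ∈ U′ → DepthLaw (F′ ν) u
      F′-depth-parent pν∈U′ depthν u∈U′ with ∈U′⁻ u∈U′
      ... | inj₁ u∈U rewrite F′≡F ν u∈U | F′≡F ν (parent∈ u∈U) = depth-parent u∈U
      ... | inj₂ refl rewrite F′x≡ν ν = λ p≢x → trans (cong (suc ∘ depth) (F′≡F ν (pν∈U p≢x))) (depthν p≢x)
        where
        pν∈U : parent ν ≢ x → parent ν ∈ U
        pν∈U p≢x with ∈U′⁻ pν∈U′
        ... | inj₁ p∈U = p∈U
        ... | inj₂ p≡x = contradiction p≡x p≢x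

      module _ (adj⇔linked : ∀ {w} → w ∈ U → Adj G x w ⇔ Linked ν (F w) x w) where

        F′-adj⇒linked : u ∈ U′ → w ∈ U′ → u ≢ w → Adj G u w → u ∼⟨ F′ ν ⟩ w
        F′-adj⇒linked u∈U′ w∈U′ u≢w uw with ∈U′⁻ u∈U′ | ∈U′⁻ w∈U′
        ... | inj₁ u∈U  | inj₁ w∈U  = relink (sym (F′≡F ν u∈U)) (sym (F′≡F ν w∈U)) (adj⇒linked u∈U w∈U u≢w uw)
        ... | inj₂ refl | inj₁ w∈U  = relink (sym (F′x≡ν ν)) (sym (F′≡F ν w∈U)) (Equivalence.to (adj⇔linked w∈U) uw)
        ... | inj₁ u∈U  | inj₂ refl =
          linked-sym (relink (sym (F′x≡ν ν)) (sym (F′≡F ν u∈U)) (Equivalence.to (adj⇔linked u∈U) (adj-sym G uw)))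
        ... | inj₂ refl | inj₂ refl = contradiction refl u≢w

        F′-linked⇒adj : u ∈ U′ → w ∈ U′ → u ≢ w → u ∼⟨ F′ ν ⟩ w → Adj G u w
        F′-linked⇒adj u∈U′ w∈U′ u≢w uw with ∈U′⁻ u∈U′ | ∈U′⁻ w∈U′
        ... | inj₁ u∈U  | inj₁ w∈U  = linked⇒adj u∈U w∈U u≢w (relink (F′≡F ν u∈U) (F′≡F ν w∈U) uw)
        ... | inj₂ refl | inj₁ w∈U  = Equivalence.from (adj⇔linked w∈U) (relink (F′x≡ν ν) (F′≡F ν w∈U) uw)
        ... | inj₁ u∈U  | inj₂ refl =
          adj-sym G (Equivalence.from (adj⇔linked u∈U) (relink (F′x≡ν ν) (F′≡F ν u∈U) (linked-sym uw)))
        ... | inj₂ refl | inj₂ refl = contradiction refl u≢w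

    extend : (ν : Node n) → parent ν ∈ U′ → block ν ∈ U′ → (parent ν ≢ x → suc (depth (F (parent ν))) ≡ depth ν) →
             (∀ {w} → w ∈ U → Adj G x w ⇔ Linked ν (F w) x w) →
             (∀ {y z} → Boundary U′ y → Boundary U′ z → Reach G (_∈ U′) y z) →
             IsPartialBlockForest U′ (F′ ν)
    extend ν pν∈U′ bν∈U′ depthν adj⇔linked connected = record
      { parent∈            = F′-closed ν parent parent∈ pν∈U′
      ; block∈             = F′-closed ν block block∈ bν∈U′
      ; depth-parent       = F′-depth-parent ν pν∈U′ depthν
      ; adj⇒linked         = F′-adj⇒linked ν adj⇔linked
      ; linked⇒adj         = F′-linked⇒adj ν adj⇔linked
      ; boundary-connected = connected
      }

  module _ {U F} (forest : IsPartialBlockForest U F) {x} (x∉U : x ∉ U) where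
    open IsPartialBlockForest forest
    open Extension forest x∉U

    newRoot : (∀ {y} → ¬ Boundary U y) → Σ (Forest n) (IsPartialBlockForest U′)
    newRoot noBoundary = F′ root , extend root x∈U′ x∈U′ (λ x≢x → contradiction refl x≢x) adj⇔linked (reach-via G toX)
      where
      root : Node n
      root = node 0 x x

      adj⇔linked : w ∈ U → Adj G x w ⇔ Linked root (F w) x w
      adj⇔linked w∈U = mk⇔ (λ xw → contradiction (w∈U , x , x∉U , xw) noBoundary) λ
        { (childOf refl)      → contradiction w∈U x∉U
        ; (parentOf p≡x)      → contradiction (subst (_∈ U) p≡x (parent∈ w∈U)) x∉U
        ; (sameBlock root≡Fw) → contradiction (subst (_∈ U) (cong parent (sym root≡Fw)) (parent∈ w∈U)) x∉U
        }

      toX : Boundary U′ y → Reach G (_∈ U′) y x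
      toX (y∈U′ , z , z∉U′ , zy) with ∈U′⁻ y∈U′
      ... | inj₁ y∈U  = contradiction (y∈U , z , z∉U′ ∘ U⊆U′ , zy) noBoundary
      ... | inj₂ refl = here x∈U′

    module _ (blockGraph : IsBlockGraph G) where

      HighestNeighbour : Fin n → Set
      HighestNeighbour y = y ∈ U × Adj G x y × (parent (F y) ≢ y → ¬ Adj G x (parent (F y)))

      climb : ∀ k → y ∈ U → Adj G x y → depth (F y) ≤ k → ∃ HighestNeighbour
      climb {y = y} k y∈U xy d≤k with parent (F y) ≟ y
      ... | yes p≡y = y , y∈U , xy , λ p≢y → contradiction p≡y p≢y
      ... | no p≢y with T? (adj x (parent (F y))) | k
      ...   | no x≁p  | _      = y , y∈U , xy , λ _ → x≁p
      ...   | yes _   | zero   = contradiction (subst (_≤ 0) (sym (depth-parent y∈U p≢y)) d≤k) λ ()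
      ...   | yes xp  | suc k′ =
        climb k′ (parent∈ y∈U) xp (≤-pred (subst (_≤ suc k′) (sym (depth-parent y∈U p≢y)) d≤k))

      module Below {y} (y∈U : y ∈ U) (xy : Adj G x y) (highest : parent (F y) ≢ y → ¬ Adj G x (parent (F y))) where
        boundary : z ∈ U → Adj G x z → Boundary U z
        boundary z∈U xz = z∈U , x , x∉U , xz

        x≢ : z ∈ U → x ≢ z
        x≢ z∈U refl = x∉U z∈U

        neighbours-adj : z ∈ U → w ∈ U → Adj G x z → Adj G x w → z ≢ w → Adj G z w
        neighbours-adj z∈U w∈U xz xw =
          commonNeighbour⇒adj G blockGraph (boundary-connected (boundary z∈U xz) (boundary w∈U xw)) x∉U xz xw

        neighbour⇒child : z ∈ U → Adj G x z → z ≢ y → parent (F z) ≡ y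
        neighbour⇒child {z = z} z∈U xz z≢y with adj⇒linked z∈U y∈U z≢y (neighbours-adj z∈U y∈U xz xy z≢y)
        ... | childOf pz≡y = pz≡y
        ... | parentOf py≡z = contradiction (subst (Adj G x) (sym py≡z) xz) (highest λ py≡y → z≢y (trans (sym py≡z) py≡y))
        ... | sameBlock Fz≡Fy with parent (F y) ≟ y | z ≟ parent (F y)
        ...   | yes py≡y | _       = trans (cong parent Fz≡Fy) py≡y
        ...   | no py≢y  | yes z≡p = contradiction (subst (Adj G x) z≡p xz) (highest py≢y)
        ...   | no py≢y  | no z≢p  = contradiction (square⇒chord G blockGraph xz zp py (adj-sym G xy) (x≢ p∈U) z≢y) (highest py≢y)
          where
          p∈U = parent∈ y∈U
          zp = linked⇒adj z∈U p∈U z≢p (childOf (cong parent Fz≡Fy))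
          py = linked⇒adj p∈U y∈U py≢y (parentOf refl)

        neighbours-sameBlock : z ∈ U → w ∈ U → Adj G x z → Adj G x w → z ≢ y → w ≢ y → F z ≡ F w
        neighbours-sameBlock {z = z} {w = w} z∈U w∈U xz xw z≢y w≢y with z ≟ w
        ... | yes refl = refl
        ... | no z≢w with adj⇒linked z∈U w∈U z≢w (neighbours-adj z∈U w∈U xz xw z≢w)
        ...   | childOf pz≡w    = contradiction (trans (sym pz≡w) (neighbour⇒child z∈U xz z≢y)) w≢y
        ...   | parentOf pw≡z   = contradiction (trans (sym pw≡z) (neighbour⇒child w∈U xw w≢y)) z≢y
        ...   | sameBlock Fz≡Fw = Fz≡Fw

        sameBlock⇒neighbour : z ∈ U → Adj G x z → z ≢ y → w ∈ U → F w ≡ F z → Adj G x w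
        sameBlock⇒neighbour {z = z} {w = w} z∈U xz z≢y w∈U Fw≡Fz with w ≟ y | w ≟ z
        ... | yes refl | _        = xy
        ... | no _     | yes refl = xz
        ... | no w≢y   | no w≢z   = square⇒chord G blockGraph xz zw wy (adj-sym G xy) (x≢ w∈U) z≢y
          where
          zw = linked⇒adj z∈U w∈U (w≢z ∘ sym) (sameBlock (sym Fw≡Fz))
          wy = linked⇒adj w∈U y∈U w≢y (childOf (trans (cong parent Fw≡Fz) (neighbour⇒child z∈U xz z≢y)))

        -- x joins the block of its other neighbours below y, or opens a new block named x.
        slot : Σ (Node n) λ ν → parent ν ≡ y × depth ν ≡ suc (depth (F y)) × block ν ∈ U′ ×
                 (∀ {w} → w ∈ U → w ≢ y → ν ≡ F w ⇔ Adj G x w)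
        slot with any? (λ z → (z ∈? U) ×-dec (T? (adj x z) ×-dec ¬? (z ≟ y)))
        ... | yes (z , z∈U , xz , z≢y) =
          F z , pz≡y , sym (trans (cong (suc ∘ depth ∘ F) (sym pz≡y)) (depth-parent z∈U λ pz≡z → z≢y (trans (sym pz≡z) pz≡y))) ,
          U⊆U′ (block∈ z∈U) ,
          λ w∈U w≢y → mk⇔ (λ Fz≡Fw → sameBlock⇒neighbour z∈U xz z≢y w∈U (sym Fz≡Fw))
                           (λ xw → neighbours-sameBlock z∈U w∈U xz xw z≢y w≢y)
          where pz≡y = neighbour⇒child z∈U xz z≢y
        ... | no noOther =
          node (suc (depth (F y))) y x , refl , refl , x∈U′ ,
          λ {w} w∈U w≢y → mk⇔ (λ ν≡Fw → contradiction (subst (_∈ U) (cong block (sym ν≡Fw)) (block∈ w∈U)) x∉U)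
                               (λ xw → contradiction (w , w∈U , xw , w≢y) noOther)

        attachBelow : Σ (Forest n) (IsPartialBlockForest U′)
        attachBelow with slot
        ... | ν , pν≡y , dν , bν∈U′ , sameBlock⇔adj =
          F′ ν , extend ν (subst (_∈ U′) (sym pν≡y) (U⊆U′ y∈U)) bν∈U′
                   (λ _ → trans (cong (λ p → suc (depth (F p))) pν≡y) (sym dν)) adj⇔linked (reach-via G toY)
          where
          adj⇔linked : w ∈ U → Adj G x w ⇔ Linked ν (F w) x w
          adj⇔linked {w = w} w∈U with w ≟ y
          ... | yes refl = mk⇔ (λ _ → childOf pν≡y) (λ _ → xy)
          ... | no w≢y = mk⇔ (sameBlock ∘ Equivalence.from (sameBlock⇔adj w∈U w≢y)) λ
            { (childOf pν≡w)   → contradiction (trans (sym pν≡y) pν≡w) (w≢y ∘ sym)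
            ; (parentOf pw≡x)  → contradiction (subst (_∈ U) pw≡x (parent∈ w∈U)) x∉U
            ; (sameBlock ν≡Fw) → Equivalence.to (sameBlock⇔adj w∈U w≢y) ν≡Fw
            }

          toY : Boundary U′ v → Reach G (_∈ U′) v y
          toY (v∈U′ , z , z∉U′ , zv) with ∈U′⁻ v∈U′
          ... | inj₁ v∈U  = reach-map G U⊆U′ (boundary-connected (v∈U , z , z∉U′ ∘ U⊆U′ , zv) (boundary y∈U xy))
          ... | inj₂ refl = step x∈U′ xy (here (U⊆U′ y∈U))

      attach : y ∈ U → Adj G x y → Σ (Forest n) (IsPartialBlockForest U′)
      attach {y = y} y∈U xy with climb (depth (F y)) y∈U xy ≤-refl
      ... | _ , y′∈U , xy′ , highest = Below.attachBelow y′∈U xy′ highest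

  module _ (blockGraph : IsBlockGraph G) where

    -- Adding the neighbours of U first keeps the boundary of U inside one component of U.
    grow : IsPartialBlockForest U F → x ∉ U → ∃ λ x → x ∉ U × Σ (Forest n) (IsPartialBlockForest (U ∪ ⁅ x ⁆))
    grow {U = U} forest x∉U with any? (boundary? U)
    ... | yes (y , y∈U , z , z∉U , zy) = z , z∉U , attach forest z∉U blockGraph y∈U zy
    ... | no noBoundary = _ , x∉U , newRoot forest x∉U (λ by → noBoundary (_ , by))

    complete : ∀ k → n ≤ ∣ U ∣ + k → IsPartialBlockForest U F → Σ (Forest n) (IsBlockForest G)
    complete {U = U} {F = F} k bound forest with any? (λ x → ¬? (x ∈? U))
    ... | no full = F , record
      { depth-parent = λ u → depth-parent (all u)
      ; adj⇒linked   = λ {u} {w} → adj⇒linked (all u) (all w)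
      ; linked⇒adj   = λ {u} {w} → linked⇒adj (all u) (all w)
      }
      where
      open IsPartialBlockForest forest
      all : ∀ u → u ∈ U
      all u with u ∈? U
      ... | yes u∈U = u∈U
      ... | no u∉U  = contradiction (u , u∉U) full
    ... | yes (x , x∉U) with grow forest x∉U | k
    ...   | x′ , x′∉U , _ , _       | zero   = contradiction (∣p∣≤n (U ∪ ⁅ x′ ⁆)) (m≤a+0∧a<b⇒b≰m bound (Extension.∣U∣<∣U′∣ forest x′∉U))
    ...   | x′ , x′∉U , _ , forest′ | suc k′ = complete k′ (m≤a+[1+k]∧a<b⇒m≤b+k bound (Extension.∣U∣<∣U′∣ forest x′∉U)) forest′

    blockForest : Σ (Forest n) (IsBlockForest G)
    blockForest = complete {F = λ u → node 0 u u} n (m≤n+m n ∣ ∅ {n} ∣) record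
      { parent∈            = ⊥-elim ∘ ∉⊥
      ; block∈             = ⊥-elim ∘ ∉⊥
      ; depth-parent       = ⊥-elim ∘ ∉⊥
      ; adj⇒linked         = λ u∈∅ → ⊥-elim (∉⊥ u∈∅)
      ; linked⇒adj         = λ u∈∅ → ⊥-elim (∉⊥ u∈∅)
      ; boundary-connected = λ (y∈∅ , _) → ⊥-elim (∉⊥ y∈∅)
      }

-- L-shaped paths in the grid

data Orientation : Set where
  horizontal vertical : Orientation

perp : Orientation → Orientation
perp horizontal = vertical
perp vertical   = horizontal

edgeAt : Orientation → ℕ → ℕ → GridEdge
edgeAt horizontal c x = hor (+ x) (+ c)
edgeAt vertical   c x = ver (+ c) (+ x)

OnSegment : Orientation → (c lo hi : ℕ) → GridEdge → Set
OnSegment d c lo hi e = ∃ λ x → e ≡ edgeAt d c x × lo ≤ x × x < hi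

onSegments-meet : ∀ {d d′ c c′ lo lo′ hi hi′ e} → OnSegment d c lo hi e → OnSegment d′ c′ lo′ hi′ e →
                  c ≡ c′ × ∃ λ x → (lo ≤ x × x < hi) × (lo′ ≤ x × x < hi′)
onSegments-meet {horizontal} {horizontal} (x , refl , bounds) (_ , refl , bounds′) = refl , x , bounds , bounds′
onSegments-meet {vertical}   {vertical}   (x , refl , bounds) (_ , refl , bounds′) = refl , x , bounds , bounds′
onSegments-meet {horizontal} {vertical}   (_ , refl , _) (_ , () , _)
onSegments-meet {vertical}   {horizontal} (_ , refl , _) (_ , () , _)

alternate : ℕ → Orientation
alternate zero    = vertical
alternate (suc d) = perp (alternate d)

perp-involutive : ∀ d → perp (perp d) ≡ d
perp-involutive horizontal = refl
perp-involutive vertical   = refl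

-- The L-shaped path with an arm from z to o on the line (perp d, p), bending at the crossing
-- with the line (d, o) and continuing there as a stem from p to t.
lPath : Orientation → (o p z t : ℕ) → p < t → B1Path
lPath vertical   o p z t p<t = record
  { cx = + o ; cy = + p ; hx = + z ; vy = + t ; nontrivial = λ (_ , t≡p) → <⇒≢ p<t (sym (+-injective t≡p)) }
lPath horizontal o p z t p<t = record
  { cx = + p ; cy = + o ; hx = + t ; vy = + z ; nontrivial = λ (t≡p , _) → <⇒≢ p<t (sym (+-injective t≡p)) }

range⁻ : ∀ {a b lo hi X} → a ⊓ b ≡ lo → a ⊔ b ≡ hi → + a ℤ.⊓ + b ℤ.≤ X → X ℤ.< + a ℤ.⊔ + b →
         ∃ λ x → X ≡ + x × lo ≤ x × x < hi
range⁻ refl refl (+≤+ lo≤x) (+<+ x<hi) = _ , refl , lo≤x , x<hi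

range⁺ : ∀ {a b lo hi x} → a ⊓ b ≡ lo → a ⊔ b ≡ hi → lo ≤ x → x < hi →
         + a ℤ.⊓ + b ℤ.≤ + x × + x ℤ.< + a ℤ.⊔ + b
range⁺ refl refl lo≤x x<hi = +≤+ lo≤x , +<+ x<hi

module _ {o p z t : ℕ} {p<t : p < t} where

  ∈lPath⁻ : ∀ d {e} → z ≤ o → e ∈ₚ lPath d o p z t p<t → OnSegment d o p t e ⊎ OnSegment (perp d) p z o e
  ∈lPath⁻ vertical {hor _ _} z≤o (refl , above , below) with range⁻ (m≤n⇒m⊓n≡m z≤o) (m≤n⇒m⊔n≡n z≤o) above below
  ... | x , refl , inside = inj₂ (x , refl , inside)
  ∈lPath⁻ vertical {ver _ _} _ (refl , above , below) with range⁻ (m≥n⇒m⊓n≡n (<⇒≤ p<t)) (m≥n⇒m⊔n≡m (<⇒≤ p<t)) above below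
  ... | x , refl , inside = inj₁ (x , refl , inside)
  ∈lPath⁻ horizontal {hor _ _} _ (refl , above , below) with range⁻ (m≥n⇒m⊓n≡n (<⇒≤ p<t)) (m≥n⇒m⊔n≡m (<⇒≤ p<t)) above below
  ... | x , refl , inside = inj₁ (x , refl , inside)
  ∈lPath⁻ horizontal {ver _ _} z≤o (refl , above , below) with range⁻ (m≤n⇒m⊓n≡m z≤o) (m≤n⇒m⊔n≡n z≤o) above below
  ... | x , refl , inside = inj₂ (x , refl , inside)

  ∈lPath-stem : ∀ d {x} → p ≤ x → x < t → edgeAt d o x ∈ₚ lPath d o p z t p<t
  ∈lPath-stem vertical   p≤x x<t = refl , range⁺ (m≥n⇒m⊓n≡n (<⇒≤ p<t)) (m≥n⇒m⊔n≡m (<⇒≤ p<t)) p≤x x<t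
  ∈lPath-stem horizontal p≤x x<t = refl , range⁺ (m≥n⇒m⊓n≡n (<⇒≤ p<t)) (m≥n⇒m⊔n≡m (<⇒≤ p<t)) p≤x x<t

  ∈lPath-arm : ∀ d {x} → z ≤ x → x < o → edgeAt (perp d) p x ∈ₚ lPath d o p z t p<t
  ∈lPath-arm vertical   z≤x x<o = refl , range⁺ (m≤n⇒m⊓n≡m z≤o) (m≤n⇒m⊔n≡n z≤o) z≤x x<o
    where z≤o = ≤-trans z≤x (<⇒≤ x<o)
  ∈lPath-arm horizontal z≤x x<o = refl , range⁺ (m≤n⇒m⊓n≡m z≤o) (m≤n⇒m⊔n≡n z≤o) z≤x x<o
    where z≤o = ≤-trans z≤x (<⇒≤ x<o)

-- Vertex u owns the grid lines of coordinate pos u; the children of u in one block hang their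
-- arms on those lines inside the window [zone, zone + N) of that block, and the windows of
-- different blocks (and of different depths) are disjoint.
module Layout {F : Forest n} (depth-parent : ∀ u → DepthLaw F u) where

  N : ℕ
  N = suc n

  cell : Node n → ℕ
  cell ν = depth ν * N + toℕ (block ν)

  zone : Node n → ℕ
  zone ν = cell ν * N

  pos : Fin n → ℕ
  pos u = zone (F u) + suc (toℕ u)

  top : Node n → ℕ
  top ν = suc (suc (depth ν)) * N * N

  orientation : Node n → Orientation
  orientation ν = alternate (depth ν)

  zone<pos : ∀ u → zone (F u) < pos u
  zone<pos u = m<m+n (zone (F u)) (s≤s z≤n)

  pos<cellEnd : ∀ u → pos u < suc (cell (F u)) * N
  pos<cellEnd u = digit< (cell (F u)) (s≤s (toℕ<n u))

  pos<layerEnd : ∀ u → pos u < suc (depth (F u)) * N * N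
  pos<layerEnd u = <-≤-trans (pos<cellEnd u) (*-monoˡ-≤ N (digit< (depth (F u)) (m<n⇒m<1+n (toℕ<n (block (F u))))))

  pos<zone : depth (F u) < depth ν → pos u < zone ν
  pos<zone {u = u} {ν = ν} d<d′ =
    <-≤-trans (pos<layerEnd u) (*-monoˡ-≤ N (≤-trans (*-monoˡ-≤ N d<d′) (m≤m+n (depth ν * N) (toℕ (block ν)))))

  pos<top : depth (F u) ≤ suc (depth ν) → pos u < top ν
  pos<top {u = u} d≤ = <-≤-trans (pos<layerEnd u) (*-monoˡ-≤ N (*-monoˡ-≤ N (s≤s d≤)))

  pos-injective : pos u ≡ pos w → u ≡ w
  pos-injective {u = u} {w = w} eq =
    toℕ-injective (suc-injective (proj₂ (digits-injective {a = cell (F u)} {b = cell (F w)} eq (s≤s (toℕ<n u)) (s≤s (toℕ<n w)))))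

  cell-injective : cell μ ≡ cell ν → depth μ ≡ depth ν × block μ ≡ block ν
  cell-injective {μ = μ} {ν = ν} eq with digits-injective {a = depth μ} {b = depth ν} eq (m<n⇒m<1+n (toℕ<n (block μ))) (m<n⇒m<1+n (toℕ<n (block ν)))
  ... | d≡ , b≡ = d≡ , toℕ-injective b≡

  arm-cell : ∀ {x} → zone (F u) ≤ x → x < pos u → x / N ≡ cell (F u)
  arm-cell {u = u} lo hi = /-block (cell (F u)) lo (<-trans hi (pos<cellEnd u))

  depth-parent≤ : ∀ u → depth (F (parent (F u))) ≤ depth (F u)
  depth-parent≤ u with parent (F u) ≟ u
  ... | yes p≡u = ≤-reflexive (cong (depth ∘ F) p≡u)
  ... | no p≢u  = ≤-trans (n≤1+n _) (≤-reflexive (depth-parent u p≢u))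

  path : Fin n → B1Path
  path u = lPath (orientation (F u)) (pos u) (pos (parent (F u))) (zone (F u)) (top (F u))
             (pos<top {ν = F u} (≤-trans (depth-parent≤ u) (n≤1+n _)))

  zoneEdge : Node n → GridEdge
  zoneEdge ν = edgeAt (perp (orientation ν)) (pos (parent ν)) (zone ν)

  zoneEdge∈path : ∀ u → zoneEdge (F u) ∈ₚ path u
  zoneEdge∈path u = ∈lPath-arm (orientation (F u)) ≤-refl (zone<pos u)

  zoneEdge∈parent : ∀ u → zoneEdge (F u) ∈ₚ path (parent (F u))
  zoneEdge∈parent u with parent (F u) ≟ u
  ... | yes p≡u = subst (λ v → zoneEdge (F u) ∈ₚ path v) (sym p≡u) (zoneEdge∈path u)
  ... | no p≢u  = subst (λ d → edgeAt d (pos p) (zone (F u)) ∈ₚ path p) perp-orientation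
                    (∈lPath-stem (orientation (F p)) (<⇒≤ (pos<zone {ν = F u} grandparent<u)) (<-trans (zone<pos u) (pos<top {ν = F p} u≤1+p)))
    where
    p = parent (F u)
    u≤1+p : depth (F u) ≤ suc (depth (F p))
    u≤1+p = ≤-reflexive (sym (depth-parent u p≢u))
    grandparent<u : depth (F (parent (F p))) < depth (F u)
    grandparent<u = ≤-<-trans (depth-parent≤ p) (≤-reflexive (depth-parent u p≢u))
    perp-orientation : orientation (F p) ≡ perp (orientation (F u))
    perp-orientation = trans (sym (perp-involutive _)) (cong (perp ∘ alternate) (depth-parent u p≢u))

  linked⇒share : u ∼⟨ F ⟩ w → ShareEdge (path u) (path w)
  linked⇒share {u = u} (childOf refl)  = zoneEdge (F u) , zoneEdge∈path u , zoneEdge∈parent u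
  linked⇒share {w = w} (parentOf refl) = zoneEdge (F w) , zoneEdge∈parent w , zoneEdge∈path w
  linked⇒share {u = u} {w = w} (sameBlock Fu≡Fw) =
    zoneEdge (F u) , zoneEdge∈path u , subst (λ ν → zoneEdge ν ∈ₚ path w) (sym Fu≡Fw) (zoneEdge∈path w)

  -- A common edge lies on a stem or an arm of each path; two stems never meet, a stem meets
  -- only the arms of its children, and two arms meet only inside a common window.
  share⇒linked : u ≢ w → ShareEdge (path u) (path w) → u ∼⟨ F ⟩ w
  share⇒linked {u = u} {w = w} u≢w (e , e∈u , e∈w)
    with ∈lPath⁻ (orientation (F u)) (<⇒≤ (zone<pos u)) e∈u | ∈lPath⁻ (orientation (F w)) (<⇒≤ (zone<pos w)) e∈w
  ... | inj₁ stem-u | inj₁ stem-w = contradiction (pos-injective (proj₁ (onSegments-meet stem-u stem-w))) u≢w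
  ... | inj₁ stem-u | inj₂ arm-w  = parentOf (sym (pos-injective (proj₁ (onSegments-meet stem-u arm-w))))
  ... | inj₂ arm-u  | inj₁ stem-w = childOf (pos-injective (proj₁ (onSegments-meet arm-u stem-w)))
  ... | inj₂ arm-u  | inj₂ arm-w with onSegments-meet arm-u arm-w
  ...   | pp≡ , x , (zu≤x , x<pu) , (zw≤x , x<pw) = sameBlock (node-≡ d≡ (pos-injective pp≡) b≡)
    where
    cells≡ = cell-injective {μ = F u} {ν = F w} (trans (sym (arm-cell {u = u} zu≤x x<pu)) (arm-cell {u = w} zw≤x x<pw))
    d≡ = proj₁ cells≡
    b≡ = proj₂ cells≡

  path-helly : ∀ S → (∀ u v → u ∈ S → v ∈ S → ShareEdge (path u) (path v)) → ∃ λ e → ∀ u → u ∈ S → e ∈ₚ path u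
  path-helly S pairwise with any? (_∈? S)
  ... | no empty = hor (+ 0) (+ 0) , λ u u∈S → contradiction (u , u∈S) empty
  ... | yes (u , u∈S) with linkedFamily-centre depth-parent (λ x∈S y∈S x≢y → share⇒linked x≢y (pairwise _ _ x∈S y∈S)) u∈S
  ...   | c , centre = zoneEdge (F c) , λ x x∈S → cover (centre x∈S)
    where
    cover : x ≡ parent (F c) ⊎ F x ≡ F c → zoneEdge (F c) ∈ₚ path x
    cover (inj₁ refl) = zoneEdge∈parent c
    cover {x = x} (inj₂ Fx≡Fc) = subst (λ ν → zoneEdge ν ∈ₚ path x) Fx≡Fc (zoneEdge∈path x)

corollary2 : (n : ℕ) (G : Graph n) → IsBlockGraph G → IsHellyB1EPG G
corollary2 n G blockGraph with blockForest G blockGraph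
... | F , forest = path , representation , path-helly
  where
  open IsBlockForest forest
  open Layout depth-parent

  representation : IsB1EPGRep G path
  representation u v u≢v = mk⇔ (linked⇒share ∘ adj⇒linked u≢v) (linked⇒adj u≢v ∘ share⇒linked u≢v)
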